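{- Let $G=(V,E)$ be a graph, $k$ an integer, and let $P=v_0v_1\dots v_{h-1}v_h$ be a degree-two-path in $G$ with $h\ge 4$. Let $G'=(V\setminus\{v_2\},\,(E\setminus\{v_1v_2,v_2v_3\})\cup\{v_1v_3\})$. Then $(G,k)$ is a yes-instance of Co-Path Packing if and only if $(G',k)$ is a yes-instance of Co-Path Packing.
   Context: Co-Path Packing: given a simple undirected graph $G=(V,E)$ and an integer $k$, decide whether there is $S\subseteq V$ with $|S|\le k$ such that $G\setminus S$ is a collection of disjoint induced paths. A path $v_0v_1\dots v_{h-1}v_h$ (consecutive vertices adjacent) is a degree-two-path if $v_0$ and $v_h$ have degree different from 2 and $v_1,\dots,v_{h-1}$ all have degree 2; $v_0=v_h$ is allowed. -}

module Defs where

open import Data.Nat using (ℕ; zero; suc; _<_; _≤_)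
open import Data.Bool using (Bool; true; false; _∨_; _∧_)
open import Data.Fin using (Fin; toℕ; punchIn; _≟_)
open import Data.Fin.Subset using (Subset; ∣_∣) renaming (_∉_ to _∉ₛ_)
open import Data.List using (List; length; filterᵇ; concat; lookup)
open import Data.List.Base using (allFin)
open import Data.List.Membership.Propositional using (_∈_)
open import Data.List.Relation.Unary.Unique.Propositional using (Unique)
open import Data.Integer using (ℤ; +_) renaming (_≤_ to _≤ℤ_)
open import Data.Product using (Σ; _×_)
open import Data.Sum using (_⊎_)
open import Relation.Binary.PropositionalEquality using (_≡_; _≢_)
open import Relation.Nullary.Decidable using (⌊_⌋)
open import Function.Bundles using (_⇔_)

Graph : ℕ → Set
Graph N = Fin N → Fin N → Bool

record Simple {N : ℕ} (adj : Graph N) : Set where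
  field
    sym    : ∀ u v → adj u v ≡ adj v u
    irrefl : ∀ v → adj v v ≡ false

deg : ∀ {N} → Graph N → Fin N → ℕ
deg {N} adj v = length (filterᵇ (adj v) (allFin N))

InducedPath : ∀ {N} → Graph N → List (Fin N) → Set
InducedPath adj P =
  ∀ (i j : Fin (length P)) →
    (adj (lookup P i) (lookup P j) ≡ true) ⇔ (toℕ i ≡ suc (toℕ j) ⊎ toℕ j ≡ suc (toℕ i))

record DisjointInducedPaths {N : ℕ} (adj : Graph N) (S : Subset N) : Set where
  field
    paths     : List (List (Fin N))
    disjoint  : Unique (concat paths)
    covers    : ∀ v → (v ∈ concat paths) ⇔ (v ∉ₛ S)
    induced   : ∀ P → P ∈ paths → InducedPath adj P
    separated : ∀ (a b : Fin (length paths)) → a ≢ b →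
                ∀ x y → x ∈ lookup paths a → y ∈ lookup paths b → adj x y ≡ false

CoPathPacking : ∀ {N} → Graph N → ℤ → Set
CoPathPacking {N} adj k =
  Σ (Subset N) λ S → (+ ∣ S ∣ ≤ℤ k) × DisjointInducedPaths adj S

record DegreeTwoPath {N : ℕ} (adj : Graph N) (h : ℕ) (p : ℕ → Fin N) : Set where
  field
    consecutive : ∀ i → i < h → adj (p i) (p (suc i)) ≡ true
    distinct    : ∀ i j → i < j → j ≤ h → p i ≡ p j → (i ≡ 0 × j ≡ h)
    startDeg    : deg adj (p 0) ≢ 2
    endDeg      : deg adj (p h) ≢ 2
    innerDeg    : ∀ i → 0 < i → i < h → deg adj (p i) ≡ 2

-- G' = (V ∖ {v₂}, (E ∖ {v₁v₂, v₂v₃}) ∪ {v₁v₃}); vertices of G' are Fin N,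
-- embedded into V = Fin (suc N) by punchIn v₂ (skipping v₂).
reduce : ∀ {N} → Graph (suc N) → (ℕ → Fin (suc N)) → Graph N
reduce adj p i j =
  adj a b ∨ ((⌊ a ≟ p 1 ⌋ ∧ ⌊ b ≟ p 3 ⌋) ∨ (⌊ a ≟ p 3 ⌋ ∧ ⌊ b ≟ p 1 ⌋))
  where
    a = punchIn (p 2) i
    b = punchIn (p 2) j

-- G′ arises from G by contracting the subpath v₁v₂v₃ of the degree-two path to the edge v₁v₃, and
-- solutions transfer in both directions without growing. From a solution S of G: if v₂ ∈ S, delete
-- v₁ instead of v₂; if v₂ ∉ S but v₁ or v₃ is in S, just drop v₂; otherwise v₂, having degree two,
-- sits between v₁ and v₃ on a path of G − S, and contracting it there gives a path of G′ − S.
-- Conversely, put v₂ back outside a solution S′ of G′: it subdivides v₁v₃ if both ends survive; if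
-- only v₁ (or v₃) survives, its sole other neighbour is v₀ (or v₄), so it ends its path and v₂
-- extends that path; otherwise v₂ is a path on its own. Each step is one operation on a list of
-- paths: deleting a vertex, joining at a cut, or splicing a vertex into a cut.
module Submission where

open import Defs
open import Data.Bool using (true; false; T; _∧_) renaming (_≟_ to _≟ᵇ_)
open import Data.Bool.Properties using (¬-not; T-≡; T-∨; T-∧)
open import Data.Empty using (⊥-elim)
open import Data.Fin using (Fin; zero; suc; toℕ; punchIn; punchOut) renaming (_≟_ to _≟ᶠ_)
open import Data.Fin.Properties using (punchIn-injective; punchInᵢ≢i; punchIn-punchOut; punchOut-punchIn)
open import Data.Fin.Subset using (Subset; ∣_∣; inside) renaming (_∉_ to _∉ₛ_)
open import Data.Fin.Subset.Properties using (_∈?_; ∣p∣≤∣x∷p∣)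
open import Data.Integer using (ℤ; +_; +≤+) renaming (_≤_ to _≤ℤ_)
import Data.Integer.Properties as ℤ
open import Data.List using (List; []; _∷_; _++_; concat; map; head; last; length; lookup; filterᵇ; allFin)
open import Data.List.Properties using (++-assoc; concat-++; concat-map)
open import Data.List.Membership.Propositional using (_∈_; _∉_; find; lose)
open import Data.List.Membership.Propositional.Properties
  using (∈-lookup; ∈-concat⁻; ∈-concat⁺′; ∈-concat⁻′; ∈-∃++; ∈-++⁺ˡ; ∈-++⁺ʳ; ∈-map⁺; ∈-map⁻;
         ∈-filter⁺; ∈-allFin)
open import Data.List.Relation.Binary.Permutation.Propositional
  using (_↭_; ↭-sym; ↭⇒↭ₛ; module PermutationReasoning)
import Data.List.Relation.Binary.Permutation.Propositional.Properties as ↭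
import Data.List.Relation.Binary.Permutation.Setoid.Properties as Permutationₛ
import Data.List.Relation.Unary.All as All
import Data.List.Relation.Unary.All.Properties as All
open import Data.List.Relation.Unary.All.Properties using (¬Any⇒All¬; All¬⇒¬Any)
open import Data.List.Relation.Unary.Any using (Any; here; there) renaming (map to Any-map)
import Data.List.Relation.Unary.Any as Any using (index)
import Data.List.Relation.Unary.Any.Properties as Any
open import Data.List.Relation.Unary.Unique.Propositional using (Unique; []; _∷_)
open import Data.List.Relation.Unary.Unique.Propositional.Properties using (Unique[x∷xs]⇒x∉xs)
open import Data.Maybe using (Maybe; just)
open import Data.Maybe.Properties using (just-injective)
open import Data.Nat using (ℕ; suc; _≤_; _<_; s≤s; z<s; s<s)
import Data.Nat.Properties as ℕ
open import Data.Product using (Σ; ∃₂; _×_; _,_; proj₁; proj₂)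
import Data.Product as Product
open import Data.Product.Function.NonDependent.Propositional using (_×-⇔_)
open import Data.Sum using (_⊎_; inj₁; inj₂)
import Data.Sum as Sum
open import Data.Sum.Function.Propositional using (_⊎-⇔_)
open import Data.Vec using (_∷_; removeAt; insertAt; _[_]≔_)
import Data.Vec as Vec using (lookup)
open import Data.Vec.Properties
  using ([]=⇒lookup; lookup⇒[]=; removeAt-punchOut; insertAt-removeAt; insertAt-punchIn; insertAt-lookup;
         lookup∘update; lookup∘update′)
open import Function using (_∘_; id; case_of_)
open import Function.Bundles using (_⇔_; mk⇔; Equivalence)
import Function.Properties.Equivalence as ⇔
open import Relation.Binary.PropositionalEquality
  using (_≡_; refl; sym; trans; cong; subst; subst₂; _≢_; setoid; module ≡-Reasoning)
open import Relation.Nullary using (¬_; Dec; yes; no; ¬?; _×-dec_)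
open import Relation.Nullary.Decidable using (T?; ⌊_⌋; toWitness; fromWitness; map′)

open Equivalence using (to; from)

-- Consecutive elements of a list

module _ {V : Set} where

  data Consecutive : List V → V → V → Set where
    now  : ∀ {x y zs} → Consecutive (x ∷ y ∷ zs) x y
    next : ∀ {z zs x y} → Consecutive zs x y → Consecutive (z ∷ zs) x y

  Seam : List V → List V → V → V → Set
  Seam ls rs x y = last ls ≡ just x × head rs ≡ just y

  Consecutive-∈ : ∀ {P x y} → Consecutive P x y → x ∈ P × y ∈ P
  Consecutive-∈ now      = here refl , there (here refl)
  Consecutive-∈ (next c) = Product.map there there (Consecutive-∈ c)

  last-∈ : ∀ {ls : List V} {x} → last ls ≡ just x → x ∈ ls
  last-∈ {_ ∷ []}     refl = here refl
  last-∈ {_ ∷ w ∷ ls} e    = there (last-∈ {w ∷ ls} e)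

  head-∈ : ∀ {rs : List V} {y} → head rs ≡ just y → y ∈ rs
  head-∈ {_ ∷ _} refl = here refl

  Consecutive-++⁻ : ∀ ls {rs x y} → Consecutive (ls ++ rs) x y →
                    Consecutive ls x y ⊎ Seam ls rs x y ⊎ Consecutive rs x y
  Consecutive-++⁻ []           c        = inj₂ (inj₂ c)
  Consecutive-++⁻ (_ ∷ [])     now      = inj₂ (inj₁ (refl , refl))
  Consecutive-++⁻ (_ ∷ [])     (next c) = inj₂ (inj₂ c)
  Consecutive-++⁻ (_ ∷ _ ∷ _)  now      = inj₁ now
  Consecutive-++⁻ (_ ∷ w ∷ ls) (next c) = Sum.map₁ next (Consecutive-++⁻ (w ∷ ls) c)

  Consecutive-++⁺ˡ : ∀ {ls rs x y} → Consecutive ls x y → Consecutive (ls ++ rs) x y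
  Consecutive-++⁺ˡ now      = now
  Consecutive-++⁺ˡ (next c) = next (Consecutive-++⁺ˡ c)

  Consecutive-++⁺ʳ : ∀ ls {rs x y} → Consecutive rs x y → Consecutive (ls ++ rs) x y
  Consecutive-++⁺ʳ []       c = c
  Consecutive-++⁺ʳ (_ ∷ ls) c = next (Consecutive-++⁺ʳ ls c)

  Seam⇒Consecutive : ∀ ls {rs x y} → Seam ls rs x y → Consecutive (ls ++ rs) x y
  Seam⇒Consecutive (_ ∷ [])     {_ ∷ _} (refl , refl) = now
  Seam⇒Consecutive (_ ∷ w ∷ ls)         s             = next (Seam⇒Consecutive (w ∷ ls) s)

  Consecutive⇒Seam : ∀ {P x y} → Consecutive P x y → ∃₂ λ ls rs → P ≡ ls ++ rs × Seam ls rs x y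
  Consecutive⇒Seam {x ∷ y ∷ zs} now = x ∷ [] , y ∷ zs , refl , refl , refl
  Consecutive⇒Seam {z ∷ _} (next c) with Consecutive⇒Seam c
  ... | [] , _ , _ , () , _
  ... | w ∷ ls , rs , refl , s = z ∷ w ∷ ls , rs , refl , s

  ∈⇒end⊎inner : ∀ {P v} → v ∈ P →
    (∃₂ λ ls rs → P ≡ ls ++ rs × ((ls ≡ [] × head rs ≡ just v) ⊎ (rs ≡ [] × last ls ≡ just v)))
    ⊎ (∃₂ λ a b → Consecutive P a v × Consecutive P v b)
  ∈⇒end⊎inner {z ∷ zs} (here refl) = inj₁ ([] , z ∷ zs , refl , inj₁ (refl , refl))
  ∈⇒end⊎inner {z ∷ _}  (there m) with ∈⇒end⊎inner m
  ... | inj₁ (_ , v ∷ [] , refl , inj₁ (refl , refl))    = inj₁ (z ∷ v ∷ [] , [] , refl , inj₂ (refl , refl))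
  ... | inj₁ (_ , v ∷ y ∷ _ , refl , inj₁ (refl , refl)) = inj₂ (z , y , now , next now)
  ... | inj₁ ([] , _ , _ , inj₂ (refl , ()))
  ... | inj₁ (w ∷ ls , _ , refl , inj₂ (refl , l))       = inj₁ (z ∷ w ∷ ls , [] , refl , inj₂ (refl , l))
  ... | inj₂ (a , b , c₁ , c₂)                           = inj₂ (a , b , next c₁ , next c₂)

  Consecutive-functional : ∀ {L x y z} → Unique L → Consecutive L x y → Consecutive L x z → y ≡ z
  Consecutive-functional _       now      now      = refl
  Consecutive-functional u       now      (next c) = ⊥-elim (Unique[x∷xs]⇒x∉xs u (proj₁ (Consecutive-∈ c)))
  Consecutive-functional u       (next c) now      = ⊥-elim (Unique[x∷xs]⇒x∉xs u (proj₁ (Consecutive-∈ c)))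
  Consecutive-functional (_ ∷ u) (next c) (next d) = Consecutive-functional u c d

  Consecutive-asym : ∀ {L x y} → Unique L → Consecutive L x y → ¬ Consecutive L y x
  Consecutive-asym u       now      now      = Unique[x∷xs]⇒x∉xs u (here refl)
  Consecutive-asym u       now      (next c) = Unique[x∷xs]⇒x∉xs u (proj₂ (Consecutive-∈ c))
  Consecutive-asym u       (next c) now      = Unique[x∷xs]⇒x∉xs u (proj₂ (Consecutive-∈ c))
  Consecutive-asym (_ ∷ u) (next c) (next d) = Consecutive-asym u c d

  Consecutive-irrefl : ∀ {L x} → Unique L → ¬ Consecutive L x x
  Consecutive-irrefl u       now      = Unique[x∷xs]⇒x∉xs u (here refl)
  Consecutive-irrefl (_ ∷ u) (next c) = Consecutive-irrefl u c

  lookup-injective : ∀ {L : List V} → Unique L → ∀ {i j} → lookup L i ≡ lookup L j → i ≡ j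
  lookup-injective {_ ∷ _} _       {zero}  {zero}  _ = refl
  lookup-injective {_ ∷ L} u       {zero}  {suc j} e =
    ⊥-elim (Unique[x∷xs]⇒x∉xs u (subst (_∈ L) (sym e) (∈-lookup j)))
  lookup-injective {_ ∷ L} u       {suc i} {zero}  e =
    ⊥-elim (Unique[x∷xs]⇒x∉xs u (subst (_∈ L) e (∈-lookup i)))
  lookup-injective {_ ∷ _} (_ ∷ u) {suc i} {suc j} e = cong suc (lookup-injective u e)

  Consecutive⇒lookup : ∀ {L x y} → Consecutive L x y →
    Σ (Fin (length L)) λ i → Σ (Fin (length L)) λ j → lookup L i ≡ x × lookup L j ≡ y × toℕ j ≡ suc (toℕ i)
  Consecutive⇒lookup now = zero , suc zero , refl , refl , refl
  Consecutive⇒lookup (next c) with Consecutive⇒lookup c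
  ... | i , j , refl , refl , e = suc i , suc j , refl , refl , cong suc e

  lookup⇒Consecutive : ∀ (L : List V) {i j} → toℕ j ≡ suc (toℕ i) → Consecutive L (lookup L i) (lookup L j)
  lookup⇒Consecutive (_ ∷ _ ∷ _) {zero}  {suc zero}    _  = now
  lookup⇒Consecutive (_ ∷ _ ∷ _) {zero}  {suc (suc _)} ()
  lookup⇒Consecutive (_ ∷ _)     {_}     {zero}        ()
  lookup⇒Consecutive (_ ∷ L)     {suc i} {suc j}       e  = next (lookup⇒Consecutive L (ℕ.suc-injective e))

  Consecutive-lookup : ∀ {L : List V} → Unique L → ∀ i j →
                       Consecutive L (lookup L i) (lookup L j) ⇔ toℕ j ≡ suc (toℕ i)
  Consecutive-lookup {L} u i j = mk⇔ indices (lookup⇒Consecutive L)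
    where
      indices : Consecutive L (lookup L i) (lookup L j) → toℕ j ≡ suc (toℕ i)
      indices c with Consecutive⇒lookup c
      ... | _ , _ , eᵢ , eⱼ , e rewrite lookup-injective u eᵢ | lookup-injective u eⱼ = e

-- Lists of paths, and cuts in them

  Succ : List (List V) → V → V → Set
  Succ ps x y = Any (λ P → Consecutive P x y) ps

  Linked : List (List V) → V → V → Set
  Linked ps x y = Succ ps x y ⊎ Succ ps y x

  Pair : V → V → V → V → Set
  Pair a b x y = (x ≡ a × y ≡ b) ⊎ (x ≡ b × y ≡ a)

  Pair-sym : ∀ {a b x y} → Pair a b x y ⇔ Pair b a x y
  Pair-sym = mk⇔ Sum.swap Sum.swap

  Succ-∈ : ∀ {ps x y} → Succ ps x y → x ∈ concat ps × y ∈ concat ps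
  Succ-∈           (here c)  = Product.map ∈-++⁺ˡ ∈-++⁺ˡ (Consecutive-∈ c)
  Succ-∈ {P ∷ _}   (there s) = Product.map (∈-++⁺ʳ P) (∈-++⁺ʳ P) (Succ-∈ s)

  Succ⇒Consecutive-concat : ∀ {ps x y} → Succ ps x y → Consecutive (concat ps) x y
  Succ⇒Consecutive-concat         (here c)  = Consecutive-++⁺ˡ c
  Succ⇒Consecutive-concat {P ∷ _} (there s) = Consecutive-++⁺ʳ P (Succ⇒Consecutive-concat s)

  Consecutive-join : ∀ ls {rs x y} → Consecutive (ls ++ rs) x y ⇔ (Succ (ls ∷ rs ∷ []) x y ⊎ Seam ls rs x y)
  Consecutive-join ls {rs} {x} {y} = mk⇔ (forth ∘ Consecutive-++⁻ ls) back
    where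
      forth : Consecutive ls x y ⊎ Seam ls rs x y ⊎ Consecutive rs x y → Succ (ls ∷ rs ∷ []) x y ⊎ Seam ls rs x y
      forth (inj₁ c)        = inj₁ (here c)
      forth (inj₂ (inj₁ s)) = inj₂ s
      forth (inj₂ (inj₂ c)) = inj₁ (there (here c))
      back : Succ (ls ∷ rs ∷ []) x y ⊎ Seam ls rs x y → Consecutive (ls ++ rs) x y
      back (inj₁ (here c))         = Consecutive-++⁺ˡ c
      back (inj₁ (there (here c))) = Consecutive-++⁺ʳ ls c
      back (inj₂ s)                = Seam⇒Consecutive ls s

  Consecutive-splice : ∀ ls u {rs x y} → Consecutive (ls ++ u ∷ rs) x y ⇔
                       (Succ (ls ∷ rs ∷ []) x y ⊎ Seam ls (u ∷ []) x y ⊎ Seam (u ∷ []) rs x y)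
  Consecutive-splice ls u {rs} {x} {y} = mk⇔ (forth ∘ Consecutive-++⁻ ls) back
    where
      forth : Consecutive ls x y ⊎ Seam ls (u ∷ rs) x y ⊎ Consecutive (u ∷ rs) x y →
              Succ (ls ∷ rs ∷ []) x y ⊎ Seam ls (u ∷ []) x y ⊎ Seam (u ∷ []) rs x y
      forth (inj₁ c)               = inj₁ (here c)
      forth (inj₂ (inj₁ s))        = inj₂ (inj₁ s)
      forth (inj₂ (inj₂ now))      = inj₂ (inj₂ (refl , refl))
      forth (inj₂ (inj₂ (next c))) = inj₁ (there (here c))
      back : Succ (ls ∷ rs ∷ []) x y ⊎ Seam ls (u ∷ []) x y ⊎ Seam (u ∷ []) rs x y →
             Consecutive (ls ++ u ∷ rs) x y
      back (inj₁ (here c))         = Consecutive-++⁺ˡ c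
      back (inj₁ (there (here c))) = Consecutive-++⁺ʳ ls (next c)
      back (inj₂ (inj₁ s))         = Seam⇒Consecutive ls s
      back (inj₂ (inj₂ s))         = Consecutive-++⁺ʳ ls (Seam⇒Consecutive (u ∷ []) s)

  Succ-replace : ∀ qs {P Ms ts x y} {X : Set} → (Consecutive P x y ⇔ (Succ Ms x y ⊎ X)) →
                 Succ (qs ++ P ∷ ts) x y ⇔ (Succ (qs ++ Ms ++ ts) x y ⊎ X)
  Succ-replace qs {P} {Ms} {ts} {x} {y} {X} P⇔Ms = mk⇔ forth back
    where
      forth : Succ (qs ++ P ∷ ts) x y → Succ (qs ++ Ms ++ ts) x y ⊎ X
      forth s with Any.++⁻ qs s
      ... | inj₁ s′         = inj₁ (Any.++⁺ˡ s′)
      ... | inj₂ (here c)   = Sum.map₁ (Any.++⁺ʳ qs ∘ Any.++⁺ˡ) (to P⇔Ms c)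
      ... | inj₂ (there s′) = inj₁ (Any.++⁺ʳ qs (Any.++⁺ʳ Ms s′))
      back : Succ (qs ++ Ms ++ ts) x y ⊎ X → Succ (qs ++ P ∷ ts) x y
      back (inj₂ e) = Any.++⁺ʳ qs (here (from P⇔Ms (inj₂ e)))
      back (inj₁ s) with Any.++⁻ qs s
      ... | inj₁ s′ = Any.++⁺ˡ s′
      ... | inj₂ s′ with Any.++⁻ Ms s′
      ...   | inj₁ m = Any.++⁺ʳ qs (here (from P⇔Ms (inj₁ m)))
      ...   | inj₂ t = Any.++⁺ʳ qs (there t)

  -- Either side of a cut may be empty, so splicing at a cut also covers extending a path at an end.
  record Cut : Set where
    constructor cut
    field
      before     : List (List V)
      left right : List V
      after      : List (List V)

  module _ (c : Cut) where
    open Cut c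

    apart joined : List (List V)
    apart  = before ++ left ∷ right ∷ after
    joined = before ++ (left ++ right) ∷ after

    spliced : V → List (List V)
    spliced u = before ++ (left ++ u ∷ right) ∷ after

    Seamed : V → V → Set
    Seamed x y = Seam left right x y ⊎ Seam left right y x

    End : V → Set
    End y = last left ≡ just y ⊎ head right ≡ just y

    private
      concat-middle : ∀ P ts → concat (before ++ P ∷ ts) ≡ concat before ++ P ++ concat ts
      concat-middle P ts = sym (concat-++ before (P ∷ ts))

      just-unique : ∀ {m : Maybe V} {a b} → m ≡ just a → m ≡ just b → a ≡ b
      just-unique e e′ = just-injective (trans (sym e) e′)

    concat-joined : concat joined ≡ concat apart
    concat-joined = begin
      concat joined                                    ≡⟨ concat-middle (left ++ right) after ⟩
      concat before ++ (left ++ right) ++ concat after ≡⟨ cong (concat before ++_) (++-assoc left right _) ⟩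
      concat before ++ left ++ right ++ concat after   ≡⟨ concat-middle left (right ∷ after) ⟨
      concat apart                                     ∎
      where open ≡-Reasoning

    concat-spliced : ∀ u → concat (spliced u) ↭ u ∷ concat apart
    concat-spliced u = begin
      concat (spliced u)                                   ≡⟨ concat-middle (left ++ u ∷ right) after ⟩
      concat before ++ (left ++ u ∷ right) ++ concat after ≡⟨ cong (concat before ++_) (++-assoc left _ _) ⟩
      concat before ++ left ++ u ∷ right ++ concat after   ≡⟨ ++-assoc (concat before) left _ ⟨
      (concat before ++ left) ++ u ∷ right ++ concat after ↭⟨ ↭.shift u (concat before ++ left) _ ⟩
      u ∷ (concat before ++ left) ++ right ++ concat after ≡⟨ cong (u ∷_) (++-assoc (concat before) left _) ⟩
      u ∷ concat before ++ left ++ right ++ concat after   ≡⟨ cong (u ∷_) (concat-middle left (right ∷ after)) ⟨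
      u ∷ concat apart                                     ∎
      where open PermutationReasoning

    left⊆apart : ∀ {v} → v ∈ left → v ∈ concat apart
    left⊆apart m = ∈-concat⁺′ m (Any.++⁺ʳ before (here refl))

    right⊆apart : ∀ {v} → v ∈ right → v ∈ concat apart
    right⊆apart m = ∈-concat⁺′ m (Any.++⁺ʳ before (there (here refl)))

    End⇒Seam : ∀ {a b} → End a → End b → a ≢ b → Seam left right a b ⊎ Seam left right b a
    End⇒Seam (inj₁ l) (inj₁ l′) a≢b = ⊥-elim (a≢b (just-unique l l′))
    End⇒Seam (inj₂ h) (inj₂ h′) a≢b = ⊥-elim (a≢b (just-unique h h′))
    End⇒Seam (inj₁ l) (inj₂ h)  _   = inj₁ (l , h)
    End⇒Seam (inj₂ h) (inj₁ l)  _   = inj₂ (l , h)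

    Seam⇒End : ∀ {a b y} → Seam left right a b → End y ⇔ (y ≡ a ⊎ y ≡ b)
    Seam⇒End (l , h) = mk⇔ (Sum.map (λ l′ → just-unique l′ l) (λ h′ → just-unique h′ h))
                           (Sum.map (λ { refl → l }) (λ { refl → h }))

    Seam⇒Seamed : ∀ {a b x y} → Seam left right a b → Seamed x y ⇔ Pair a b x y
    Seam⇒Seamed (l , h) = mk⇔
      (Sum.map (λ { (l′ , h′) → just-unique l′ l , just-unique h′ h })
               (λ { (l′ , h′) → just-unique h′ h , just-unique l′ l }))
      (Sum.map (λ { (refl , refl) → l , h }) (λ { (refl , refl) → l , h }))

    Succ-joined : ∀ {x y} → Succ joined x y ⇔ (Succ apart x y ⊎ Seam left right x y)
    Succ-joined = Succ-replace before (Consecutive-join left)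

    Succ-spliced : ∀ {u x y} → Succ (spliced u) x y ⇔
                   (Succ apart x y ⊎ Seam left (u ∷ []) x y ⊎ Seam (u ∷ []) right x y)
    Succ-spliced {u} = Succ-replace before (Consecutive-splice left u)

    Linked-joined : ∀ {x y} → Linked joined x y ⇔ (Linked apart x y ⊎ Seamed x y)
    Linked-joined {x} {y} = mk⇔ forth back
      where
        forth : Linked joined x y → Linked apart x y ⊎ Seamed x y
        forth (inj₁ s) = Sum.map inj₁ inj₁ (to Succ-joined s)
        forth (inj₂ s) = Sum.map inj₂ inj₂ (to Succ-joined s)
        back : Linked apart x y ⊎ Seamed x y → Linked joined x y
        back (inj₁ (inj₁ s)) = inj₁ (from Succ-joined (inj₁ s))
        back (inj₁ (inj₂ s)) = inj₂ (from Succ-joined (inj₁ s))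
        back (inj₂ (inj₁ s)) = inj₁ (from Succ-joined (inj₂ s))
        back (inj₂ (inj₂ s)) = inj₂ (from Succ-joined (inj₂ s))

    Linked-spliced : ∀ {u x y} → x ≢ u → y ≢ u → Linked (spliced u) x y ⇔ Linked apart x y
    Linked-spliced {u} x≢u y≢u = mk⇔ (Sum.map (unsplice x≢u y≢u) (unsplice y≢u x≢u))
                                     (Sum.map (from Succ-spliced ∘ inj₁) (from Succ-spliced ∘ inj₁))
      where
        unsplice : ∀ {a b} → a ≢ u → b ≢ u → Succ (spliced u) a b → Succ apart a b
        unsplice a≢u b≢u s with to Succ-spliced s
        ... | inj₁ s′             = s′
        ... | inj₂ (inj₁ (_ , e)) = ⊥-elim (b≢u (sym (just-injective e)))
        ... | inj₂ (inj₂ (e , _)) = ⊥-elim (a≢u (sym (just-injective e)))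

    Linked-spliced-new : ∀ {u y} → u ∉ concat apart → Linked (spliced u) u y ⇔ End y
    Linked-spliced-new {u} {y} u∉ = mk⇔ forth back
      where
        forth : Linked (spliced u) u y → End y
        forth (inj₁ s) with to Succ-spliced s
        ... | inj₁ s′             = ⊥-elim (u∉ (proj₁ (Succ-∈ s′)))
        ... | inj₂ (inj₁ (l , _)) = ⊥-elim (u∉ (left⊆apart (last-∈ l)))
        ... | inj₂ (inj₂ (_ , h)) = inj₂ h
        forth (inj₂ s) with to Succ-spliced s
        ... | inj₁ s′             = ⊥-elim (u∉ (proj₂ (Succ-∈ s′)))
        ... | inj₂ (inj₁ (l , _)) = inj₁ l
        ... | inj₂ (inj₂ (_ , h)) = ⊥-elim (u∉ (right⊆apart (head-∈ h)))
        back : End y → Linked (spliced u) u y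
        back (inj₁ l) = inj₂ (from Succ-spliced (inj₂ (inj₁ (l , refl))))
        back (inj₂ h) = inj₁ (from Succ-spliced (inj₂ (inj₂ (refl , h))))

    ∈-spliced : ∀ {u v} → v ∈ concat (spliced u) ⇔ (v ≡ u ⊎ v ∈ concat apart)
    ∈-spliced {u} = mk⇔ (uncons ∘ ↭.∈-resp-↭ (concat-spliced u))
                        (↭.∈-resp-↭ (↭-sym (concat-spliced u)) ∘ cons)
      where
        uncons : ∀ {v xs} → v ∈ u ∷ xs → v ≡ u ⊎ v ∈ xs
        uncons (here e)  = inj₁ e
        uncons (there m) = inj₂ m
        cons : ∀ {v xs} → v ≡ u ⊎ v ∈ xs → v ∈ u ∷ xs
        cons (inj₁ e) = here e
        cons (inj₂ m) = there m

    unique-spliced : ∀ {u} → Unique (concat (spliced u)) ⇔ (u ∉ concat apart × Unique (concat apart))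
    unique-spliced {u} = mk⇔
      (λ U → case Permutationₛ.Unique-resp-↭ (setoid V) (↭⇒↭ₛ (concat-spliced u)) U of λ
         { (u∉ ∷ U′) → All¬⇒¬Any u∉ , U′ })
      (λ { (u∉ , U) → Permutationₛ.Unique-resp-↭ (setoid V) (↭⇒↭ₛ (↭-sym (concat-spliced u)))
                                                  (¬Any⇒All¬ _ u∉ ∷ U) })

  ∈-concat⇒spliced : ∀ {ps u} → u ∈ concat ps → Σ Cut λ c → ps ≡ spliced c u
  ∈-concat⇒spliced {ps} m with ∈-concat⁻′ ps m
  ... | P , u∈P , P∈ps with ∈-∃++ P∈ps | ∈-∃++ u∈P
  ...   | qs , ts , refl | ls , rs , refl = cut qs ls rs ts , refl

  Succ⇒joined : ∀ {ps x y} → Succ ps x y → Σ Cut λ c → ps ≡ joined c × Seam (Cut.left c) (Cut.right c) x y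
  Succ⇒joined s with find s
  ... | P , P∈ps , c with ∈-∃++ P∈ps | Consecutive⇒Seam c
  ...   | qs , ts , refl | ls , rs , refl , seam = cut qs ls rs ts , refl , seam

  ∈-concat⇒end⊎inner : ∀ {ps v} → v ∈ concat ps →
    (Σ Cut λ c → ps ≡ joined c × (∀ {x y} → ¬ Seamed c x y) × (∀ {y} → End c y ⇔ y ≡ v))
    ⊎ (∃₂ λ a b → Succ ps a v × Succ ps v b)
  ∈-concat⇒end⊎inner {ps} {v} m with ∈-concat⁻′ ps m
  ... | P , v∈P , P∈ps with ∈-∃++ P∈ps | ∈⇒end⊎inner v∈P
  ...   | qs , ts , refl | inj₁ (_ , rs , refl , inj₁ (refl , h)) =
          inj₁ (cut qs [] rs ts , refl , (λ { (inj₁ (() , _)) ; (inj₂ (() , _)) }) ,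
                mk⇔ (λ { (inj₂ h′) → just-injective (trans (sym h′) h) }) (λ { refl → inj₂ h }))
  ...   | qs , ts , refl | inj₁ (ls , _ , refl , inj₂ (refl , l)) =
          inj₁ (cut qs ls [] ts , refl , (λ { (inj₁ (_ , ())) ; (inj₂ (_ , ())) }) ,
                mk⇔ (λ { (inj₁ l′) → just-injective (trans (sym l′) l) }) (λ { refl → inj₁ l }))
  ...   | qs , ts , refl | inj₂ (a , b , c₁ , c₂) =
          inj₂ (a , b , Any.++⁺ʳ qs (here c₁) , Any.++⁺ʳ qs (here c₂))

  unique-++ˡ : ∀ (xs : List V) {ys} → Unique (xs ++ ys) → Unique xs
  unique-++ˡ []       _        = []
  unique-++ˡ (_ ∷ xs) (x∉ ∷ U) = All.tabulate (λ m → All.lookup x∉ (∈-++⁺ˡ m)) ∷ unique-++ˡ xs U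

  unique-++ʳ : ∀ (xs : List V) {ys} → Unique (xs ++ ys) → Unique ys
  unique-++ʳ []       U       = U
  unique-++ʳ (_ ∷ xs) (_ ∷ U) = unique-++ʳ xs U

  unique-++-disjoint : ∀ (xs : List V) {ys x} → Unique (xs ++ ys) → x ∈ xs → x ∉ ys
  unique-++-disjoint (_ ∷ xs) (x∉ ∷ _) (here refl) m = All.lookup x∉ (∈-++⁺ʳ xs m) refl
  unique-++-disjoint (_ ∷ xs) (_ ∷ U)  (there m′)  m = unique-++-disjoint xs U m′ m

  ∈-lookup⇒∈-concat : ∀ (ps : List (List V)) a {x} → x ∈ lookup ps a → x ∈ concat ps
  ∈-lookup⇒∈-concat (P ∷ _)  zero    m = ∈-++⁺ˡ m
  ∈-lookup⇒∈-concat (P ∷ ps) (suc a) m = ∈-++⁺ʳ P (∈-lookup⇒∈-concat ps a m)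

  ∈⇒lookup : ∀ {P : List V} {x} → x ∈ P → Σ (Fin (length P)) λ i → lookup P i ≡ x
  ∈⇒lookup m = Any.index m , sym (Any.lookup-index m)

  ∈-concat⇒∈-lookup : ∀ (ps : List (List V)) {x} → x ∈ concat ps → Σ (Fin (length ps)) λ a → x ∈ lookup ps a
  ∈-concat⇒∈-lookup ps m = Any.index (∈-concat⁻ ps m) , Any.lookup-index (∈-concat⁻ ps m)

  unique-lookup : ∀ (ps : List (List V)) → Unique (concat ps) → ∀ a → Unique (lookup ps a)
  unique-lookup (P ∷ _)  U zero    = unique-++ˡ P U
  unique-lookup (P ∷ ps) U (suc a) = unique-lookup ps (unique-++ʳ P U) a

  lookup-disjoint : ∀ (ps : List (List V)) {x} → Unique (concat ps) → ∀ a b →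
                    x ∈ lookup ps a → x ∈ lookup ps b → a ≡ b
  lookup-disjoint (_ ∷ _)  U zero    zero    _  _  = refl
  lookup-disjoint (P ∷ ps) U zero    (suc b) mᵃ mᵇ =
    ⊥-elim (unique-++-disjoint P U mᵃ (∈-lookup⇒∈-concat ps b mᵇ))
  lookup-disjoint (P ∷ ps) U (suc a) zero    mᵃ mᵇ =
    ⊥-elim (unique-++-disjoint P U mᵇ (∈-lookup⇒∈-concat ps a mᵃ))
  lookup-disjoint (P ∷ ps) U (suc a) (suc b) mᵃ mᵇ = cong suc (lookup-disjoint ps (unique-++ʳ P U) a b mᵃ mᵇ)

  Succ⇒lookup : ∀ {ps : List (List V)} {x y} → Succ ps x y → Σ (Fin (length ps)) λ a → Consecutive (lookup ps a) x y
  Succ⇒lookup s = Any.index s , Any.lookup-index s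

  Succ-within : ∀ (ps : List (List V)) {x y} → Unique (concat ps) → ∀ a → x ∈ lookup ps a →
                Succ ps x y ⇔ Consecutive (lookup ps a) x y
  Succ-within ps U a x∈ = mk⇔
    (λ s → case Succ⇒lookup s of λ { (b , c) →
             subst (λ b → Consecutive (lookup ps b) _ _) (lookup-disjoint ps U b a (proj₁ (Consecutive-∈ c)) x∈) c })
    (lose (∈-lookup a))

-- Path partitions

  -- The index-free form of `DisjointInducedPaths`.
  record PathPartition (R : V → V → Set) (In : V → Set) (ps : List (List V)) : Set where
    field
      unique : Unique (concat ps)
      covers : ∀ {v} → v ∈ concat ps ⇔ In v
      linked : ∀ {x y} → In x → In y → R x y ⇔ Linked ps x y

  module _ {R : V → V → Set} {In : V → Set} where
    open PathPartition

    PathPartition-cong : ∀ {R′ In′ ps} → (∀ {v} → In v ⇔ In′ v) →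
                         (∀ {x y} → In x → In y → R x y ⇔ R′ x y) →
                         PathPartition R In ps → PathPartition R′ In′ ps
    PathPartition-cong In⇔In′ R⇔R′ π = record
      { unique = unique π
      ; covers = ⇔.trans (covers π) In⇔In′
      ; linked = λ ix iy → let ix′ = from In⇔In′ ix; iy′ = from In⇔In′ iy in
                           ⇔.trans (⇔.sym (R⇔R′ ix′ iy′)) (linked π ix′ iy′)
      }

    PathPartition-∷[] : ∀ {ps} → PathPartition R In ps → PathPartition R In ([] ∷ ps)
    PathPartition-∷[] π = record
      { unique = unique π
      ; covers = covers π
      ; linked = λ ix iy → ⇔.trans (linked π ix iy) (mk⇔ (Sum.map there there) (Sum.map drop drop))
      }
      where
        drop : ∀ {ps x y} → Succ ([] ∷ ps) x y → Succ ps x y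
        drop (there s) = s

    delete : ∀ c {u} → PathPartition R In (spliced c u) → PathPartition R (λ x → In x × x ≢ u) (apart c)
    delete c {u} π = record
      { unique = proj₂ U
      ; covers = mk⇔ (λ m → to (covers π) (from (∈-spliced c) (inj₂ m)) , λ { refl → proj₁ U m })
                     (λ { (iv , v≢u) → case to (∈-spliced c) (from (covers π) iv) of λ
                            { (inj₁ v≡u) → ⊥-elim (v≢u v≡u) ; (inj₂ m) → m } })
      ; linked = λ { (ix , x≢u) (iy , y≢u) → ⇔.trans (linked π ix iy) (Linked-spliced c x≢u y≢u) }
      }
      where U = to (unique-spliced c) (unique π)

    delete-vertex : ∀ {ps} u → Dec (In u) → PathPartition R In ps →
                    Σ (List (List V)) (PathPartition R (λ x → In x × x ≢ u))
    delete-vertex {ps} u (yes iu) π with ∈-concat⇒spliced {ps = ps} (from (covers π) iu)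
    ... | c , refl = apart c , delete c π
    delete-vertex u (no ¬iu) π =
      _ , PathPartition-cong (mk⇔ (λ ix → ix , λ { refl → ¬iu ix }) proj₁) (λ _ _ → ⇔.refl) π

    join : ∀ c → PathPartition R In (apart c) → PathPartition (λ x y → R x y ⊎ Seamed c x y) In (joined c)
    join c π = record
      { unique = subst Unique (sym (concat-joined c)) (unique π)
      ; covers = λ {v} → subst (λ L → v ∈ L ⇔ In v) (sym (concat-joined c)) (covers π)
      ; linked = λ ix iy → ⇔.trans (linked π ix iy ⊎-⇔ ⇔.refl) (⇔.sym (Linked-joined c))
      }

    splice : ∀ c {u R′} → PathPartition R In (joined c) → ¬ In u →
      (∀ {x y} → R′ x y → R′ y x) →
      (∀ {x y} → In x → In y → R′ x y ⇔ (R x y × ¬ Seamed c x y)) →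
      (∀ {y} → In y → R′ u y ⇔ End c y) → ¬ R′ u u →
      PathPartition R′ (λ x → In x ⊎ x ≡ u) (spliced c u)
    splice c {u} {R′} π u∉In R′-sym R′-old R′-new R′-irrefl = record
      { unique = U
      ; covers = ⇔.trans (∈-spliced c) (⇔.trans (⇔.refl ⊎-⇔ covers-apart) (mk⇔ Sum.swap Sum.swap))
      ; linked = linked′
      }
      where
        open Cut c
        covers-apart : ∀ {v} → v ∈ concat (apart c) ⇔ In v
        covers-apart {v} = subst (λ L → v ∈ L ⇔ In v) (concat-joined c) (covers π)
        u∉ : u ∉ concat (apart c)
        u∉ = u∉In ∘ to covers-apart
        U : Unique (concat (spliced c u))
        U = from (unique-spliced c) (u∉ , subst Unique (concat-joined c) (unique π))
        In⇒≢u : ∀ {x} → In x → x ≢ u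
        In⇒≢u ix refl = u∉In ix
        -- In `spliced c u` the left end of the seam is followed by u, and in `joined c` the seam
        -- itself is consecutive; either way a seam pair cannot be consecutive in `apart c`.
        seam⇒¬Linked : ∀ {a b} → b ≢ u → Seam left right a b → ¬ Linked (apart c) a b
        seam⇒¬Linked b≢u s (inj₁ ab) = b≢u (Consecutive-functional U
          (Succ⇒Consecutive-concat (from (Succ-spliced c) (inj₁ ab)))
          (Succ⇒Consecutive-concat (from (Succ-spliced c) (inj₂ (inj₁ (proj₁ s , refl))))))
        seam⇒¬Linked b≢u s (inj₂ ba) = Consecutive-asym (unique π)
          (Succ⇒Consecutive-concat (from (Succ-joined c) (inj₂ s)))
          (Succ⇒Consecutive-concat (from (Succ-joined c) (inj₁ ba)))
        cut-seam : ∀ {x y} → In x → In y → (Linked (joined c) x y × ¬ Seamed c x y) ⇔ Linked (apart c) x y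
        cut-seam ix iy = mk⇔
          (λ { (l , ¬s) → Sum.[ id , ⊥-elim ∘ ¬s ] (to (Linked-joined c) l) })
          (λ l → from (Linked-joined c) (inj₁ l) ,
                 Sum.[ (λ s → seam⇒¬Linked (In⇒≢u iy) s l)
                     , (λ s → seam⇒¬Linked (In⇒≢u ix) s (Sum.swap l)) ])
        linked′ : ∀ {x y} → In x ⊎ x ≡ u → In y ⊎ y ≡ u → R′ x y ⇔ Linked (spliced c u) x y
        linked′ (inj₁ ix) (inj₁ iy) =
          ⇔.trans (R′-old ix iy) (⇔.trans (linked π ix iy ×-⇔ ⇔.refl)
                  (⇔.trans (cut-seam ix iy) (⇔.sym (Linked-spliced c (In⇒≢u ix) (In⇒≢u iy)))))
        linked′ (inj₂ refl) (inj₁ iy) = ⇔.trans (R′-new iy) (⇔.sym (Linked-spliced-new c u∉))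
        linked′ (inj₁ ix) (inj₂ refl) =
          ⇔.trans (mk⇔ R′-sym R′-sym) (⇔.trans (linked′ (inj₂ refl) (inj₁ ix)) (mk⇔ Sum.swap Sum.swap))
        linked′ (inj₂ refl) (inj₂ refl) = mk⇔ (⊥-elim ∘ R′-irrefl)
          (λ l → ⊥-elim (Consecutive-irrefl U (Succ⇒Consecutive-concat (Sum.[ id , id ]′ l))))

module _ {A B : Set} (f : A → B) where
  open PathPartition

  Consecutive-map⁺ : ∀ {P x y} → Consecutive P x y → Consecutive (map f P) (f x) (f y)
  Consecutive-map⁺ now      = now
  Consecutive-map⁺ (next c) = next (Consecutive-map⁺ c)

  Consecutive-map⁻ : ∀ {P x y} → Consecutive (map f P) x y → ∃₂ λ a b → Consecutive P a b × f a ≡ x × f b ≡ y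
  Consecutive-map⁻ {_ ∷ _ ∷ _} now      = _ , _ , now , refl , refl
  Consecutive-map⁻ {_ ∷ _}     (next c) with Consecutive-map⁻ c
  ... | a , b , c′ , eᵃ , eᵇ = a , b , next c′ , eᵃ , eᵇ

  unique-map : ∀ {L} → (∀ {x y} → x ∈ L → y ∈ L → f x ≡ f y → x ≡ y) → Unique L → Unique (map f L)
  unique-map         inj []       = []
  unique-map {x ∷ L} inj (x∉ ∷ U) =
    All.map⁺ (All.tabulate λ m fx≡fy → All.lookup x∉ m (inj (here refl) (there m) fx≡fy))
    ∷ unique-map (λ m m′ → inj (there m) (there m′)) U

  Succ-map⁻ : ∀ {Q : A → Set} {ps a b} → (∀ {x y} → Q x → Q y → f x ≡ f y → x ≡ y) →
              (∀ {v} → v ∈ concat ps → Q v) → Q a → Q b → Succ (map (map f) ps) (f a) (f b) → Succ ps a b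
  Succ-map⁻ {ps = _ ∷ _} inj members qa qb (here c) with Consecutive-map⁻ c
  ... | a′ , b′ , c′ , eᵃ , eᵇ with Consecutive-∈ c′
  ...   | a′∈ , b′∈ with inj (members (∈-++⁺ˡ a′∈)) qa eᵃ | inj (members (∈-++⁺ˡ b′∈)) qb eᵇ
  ...     | refl | refl = here c′
  Succ-map⁻ {ps = P ∷ _} inj members qa qb (there s) = there (Succ-map⁻ inj (members ∘ ∈-++⁺ʳ P) qa qb s)

  PathPartition-map : ∀ {R : A → A → Set} {In : A → Set} {R′ : B → B → Set} {In′ : B → Set} {ps} →
    (∀ {x y} → In x → In y → f x ≡ f y → x ≡ y) →
    (∀ {b} → In′ b ⇔ (Σ A λ a → In a × f a ≡ b)) →
    (∀ {x y} → In x → In y → R′ (f x) (f y) ⇔ R x y) →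
    PathPartition R In ps → PathPartition R′ In′ (map (map f) ps)
  PathPartition-map {In = In} {R′ = R′} {In′ = In′} {ps} inj In′⇔ R′⇔R π = record
    { unique = subst Unique (sym (concat-map ps)) (unique-map (λ m m′ → inj (member m) (member m′)) (unique π))
    ; covers = covers′
    ; linked = linked′
    }
    where
      member : ∀ {v} → v ∈ concat ps → In v
      member = to (covers π)
      covers′ : ∀ {b} → b ∈ concat (map (map f) ps) ⇔ In′ b
      covers′ {b} = mk⇔
        (λ m → case ∈-map⁻ f (subst (b ∈_) (concat-map ps) m) of λ
           { (a , a∈ , refl) → from In′⇔ (a , member a∈ , refl) })
        (λ ib → case to In′⇔ ib of λ
           { (a , ia , refl) → subst (b ∈_) (sym (concat-map ps)) (∈-map⁺ f (from (covers π) ia)) })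
      Succ-map : ∀ {a b} → In a → In b → Succ ps a b ⇔ Succ (map (map f) ps) (f a) (f b)
      Succ-map ia ib = mk⇔ (Any.map⁺ ∘ Any-map Consecutive-map⁺) (Succ-map⁻ inj member ia ib)
      linked′ : ∀ {x y} → In′ x → In′ y → R′ x y ⇔ Linked (map (map f) ps) x y
      linked′ ix iy with to In′⇔ ix | to In′⇔ iy
      ... | a , ia , refl | b , ib , refl =
        ⇔.trans (R′⇔R ia ib) (⇔.trans (linked π ia ib) (Succ-map ia ib ⊎-⇔ Succ-map ib ia))

-- Graphs

Edge : ∀ {N} → Graph N → Fin N → Fin N → Set
Edge adj x y = adj x y ≡ true

module _ {N : ℕ} (adj : Graph N) (S : Subset N) where
  open PathPartition
  open DisjointInducedPaths

  DisjointInducedPaths⇒PathPartition : (D : DisjointInducedPaths adj S) → PathPartition (Edge adj) (_∉ₛ S) (paths D)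
  DisjointInducedPaths⇒PathPartition D = record
    { unique = disjoint D
    ; covers = λ {v} → covers D v
    ; linked = λ ix iy → mk⇔ (Edge⇒Linked ix iy) Linked⇒Edge
    }
    where
      induced-at : ∀ a i j → Edge adj (lookup (lookup (paths D) a) i) (lookup (lookup (paths D) a) j) ⇔
                   (toℕ i ≡ suc (toℕ j) ⊎ toℕ j ≡ suc (toℕ i))
      induced-at a = induced D _ (∈-lookup a)
      Succ⇒Edge : ∀ {x y} → Succ (paths D) x y → Edge adj x y × Edge adj y x
      Succ⇒Edge s with Succ⇒lookup s
      ... | a , c with Consecutive⇒lookup c
      ...   | i , j , refl , refl , e = from (induced-at a i j) (inj₂ e) , from (induced-at a j i) (inj₁ e)
      Linked⇒Edge : ∀ {x y} → Linked (paths D) x y → Edge adj x y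
      Linked⇒Edge (inj₁ s) = proj₁ (Succ⇒Edge s)
      Linked⇒Edge (inj₂ s) = proj₂ (Succ⇒Edge s)
      Edge⇒Linked : ∀ {x y} → x ∉ₛ S → y ∉ₛ S → Edge adj x y → Linked (paths D) x y
      Edge⇒Linked {x} {y} ix iy xy
        with ∈-concat⇒∈-lookup (paths D) (from (covers D x) ix) | ∈-concat⇒∈-lookup (paths D) (from (covers D y) iy)
      ... | a , x∈ | b , y∈ with a ≟ᶠ b
      ...   | no a≢b = case trans (sym xy) (separated D a b a≢b x y x∈ y∈) of λ ()
      ...   | yes refl with ∈⇒lookup x∈ | ∈⇒lookup y∈
      ...     | i , refl | j , refl with to (induced-at a i j) xy
      ...       | inj₁ e = inj₂ (lose (∈-lookup a) (lookup⇒Consecutive _ e))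
      ...       | inj₂ e = inj₁ (lose (∈-lookup a) (lookup⇒Consecutive _ e))

  PathPartition⇒DisjointInducedPaths : ∀ {ps} → PathPartition (Edge adj) (_∉ₛ S) ps → DisjointInducedPaths adj S
  PathPartition⇒DisjointInducedPaths {ps} π = record
    { paths     = ps
    ; disjoint  = unique π
    ; covers    = λ v → covers π
    ; induced   = induced′
    ; separated = separated′
    }
    where
      U = unique π
      ∉S-at : ∀ a {x} → x ∈ lookup ps a → x ∉ₛ S
      ∉S-at a m = to (covers π) (∈-lookup⇒∈-concat ps a m)
      induced′ : ∀ P → P ∈ ps → InducedPath adj P
      induced′ P P∈ i j with ∈⇒lookup P∈
      ... | a , refl =
        ⇔.trans (linked π (∉S-at a (∈-lookup i)) (∉S-at a (∈-lookup j)))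
       (⇔.trans (Succ-within ps U a (∈-lookup i) ⊎-⇔ Succ-within ps U a (∈-lookup j))
       (⇔.trans (Consecutive-lookup (unique-lookup ps U a) i j ⊎-⇔ Consecutive-lookup (unique-lookup ps U a) j i)
                (mk⇔ Sum.swap Sum.swap)))
      same-path : ∀ {x y} a b → x ∈ lookup ps a → y ∈ lookup ps b → Succ ps x y → a ≡ b
      same-path a b x∈ y∈ s with Succ⇒lookup s
      ... | c , cons = trans (lookup-disjoint ps U a c x∈ (proj₁ (Consecutive-∈ cons)))
                             (lookup-disjoint ps U c b (proj₂ (Consecutive-∈ cons)) y∈)
      separated′ : ∀ a b → a ≢ b → ∀ x y → x ∈ lookup ps a → y ∈ lookup ps b → adj x y ≡ false
      separated′ a b a≢b x y x∈ y∈ = ¬-not λ xy →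
        a≢b (case to (linked π (∉S-at a x∈) (∉S-at b y∈)) xy of λ
          { (inj₁ s) → same-path a b x∈ y∈ s
          ; (inj₂ s) → sym (same-path b a y∈ x∈ s) })

∈-length-2 : ∀ {V : Set} (L : List V) {a b c} → length L ≡ 2 →
             a ∈ L → b ∈ L → a ≢ b → c ∈ L → c ≡ a ⊎ c ≡ b
∈-length-2 (x ∷ y ∷ []) _ a∈ b∈ a≢b c∈ = cover a≢b (∈-pair a∈) (∈-pair b∈) (∈-pair c∈)
  where
    ∈-pair : ∀ {z} → z ∈ x ∷ y ∷ [] → z ≡ x ⊎ z ≡ y
    ∈-pair (here e)         = inj₁ e
    ∈-pair (there (here e)) = inj₂ e
    cover : ∀ {a b c} → a ≢ b → a ≡ x ⊎ a ≡ y → b ≡ x ⊎ b ≡ y → c ≡ x ⊎ c ≡ y → c ≡ a ⊎ c ≡ b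
    cover a≢b (inj₁ refl) (inj₁ refl) _           = ⊥-elim (a≢b refl)
    cover a≢b (inj₂ refl) (inj₂ refl) _           = ⊥-elim (a≢b refl)
    cover _   (inj₁ refl) (inj₂ refl) (inj₁ refl) = inj₁ refl
    cover _   (inj₁ refl) (inj₂ refl) (inj₂ refl) = inj₂ refl
    cover _   (inj₂ refl) (inj₁ refl) (inj₁ refl) = inj₂ refl
    cover _   (inj₂ refl) (inj₁ refl) (inj₂ refl) = inj₁ refl

Edge-deg-two : ∀ {N} (adj : Graph N) {v a b c} → deg adj v ≡ 2 → Edge adj v a → Edge adj v b → a ≢ b →
               Edge adj v c → c ≡ a ⊎ c ≡ b
Edge-deg-two {N} adj {v} d ea eb a≢b ec =
  ∈-length-2 (filterᵇ (adj v) (allFin N)) d (neighbour ea) (neighbour eb) a≢b (neighbour ec)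
  where
    neighbour : ∀ {x} → Edge adj v x → x ∈ filterᵇ (adj v) (allFin N)
    neighbour {x} e = ∈-filter⁺ (T? ∘ adj v) (∈-allFin x) (from T-≡ e)

reduce-Edge : ∀ {N} (adj : Graph (suc N)) (p : ℕ → Fin (suc N)) i j → let a = punchIn (p 2) i; b = punchIn (p 2) j in
              Edge (reduce adj p) i j ⇔ (Edge adj a b ⊎ Pair (p 1) (p 3) a b)
reduce-Edge adj p i j =
  ⇔.trans (⇔.sym T-≡) (⇔.trans (T-∨ {adj a b})
    (T-≡ ⊎-⇔ ⇔.trans (T-∨ {⌊ a ≟ᶠ p 1 ⌋ ∧ ⌊ b ≟ᶠ p 3 ⌋})
                     (both (a ≟ᶠ p 1) (b ≟ᶠ p 3) ⊎-⇔ both (a ≟ᶠ p 3) (b ≟ᶠ p 1))))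
  where
    a = punchIn (p 2) i
    b = punchIn (p 2) j
    decided : ∀ {P : Set} (d : Dec P) → T ⌊ d ⌋ ⇔ P
    decided d = mk⇔ (toWitness {a? = d}) (fromWitness {a? = d})
    both : ∀ {P Q : Set} (d : Dec P) (e : Dec Q) → T (⌊ d ⌋ ∧ ⌊ e ⌋) ⇔ (P × Q)
    both d e = ⇔.trans (T-∧ {⌊ d ⌋}) (decided d ×-⇔ decided e)

-- Subsets

∉ₛ⇔≡false : ∀ {n} {p : Subset n} {x} → x ∉ₛ p ⇔ Vec.lookup p x ≡ false
∉ₛ⇔≡false {p = p} {x} = mk⇔ (λ x∉ → ¬-not (x∉ ∘ lookup⇒[]= x p))
                             (λ e m → case trans (sym ([]=⇒lookup m)) e of λ ())

lookup-removeAt : ∀ {n} (p : Subset (suc n)) v i → Vec.lookup (removeAt p v) i ≡ Vec.lookup p (punchIn v i)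
lookup-removeAt p v i = subst (λ j → Vec.lookup (removeAt p v) j ≡ Vec.lookup p (punchIn v i)) (punchOut-punchIn v)
                              (removeAt-punchOut p (punchInᵢ≢i v i ∘ sym))

∣insertAt∣ : ∀ {n} (p : Subset n) i b → ∣ insertAt p i b ∣ ≡ ∣ b ∷ p ∣
∣insertAt∣ p           zero    b     = refl
∣insertAt∣ (true ∷ p)  (suc i) true  = cong suc (∣insertAt∣ p i true)
∣insertAt∣ (true ∷ p)  (suc i) false = cong suc (∣insertAt∣ p i false)
∣insertAt∣ (false ∷ p) (suc i) b     = ∣insertAt∣ p i b

∣removeAt∣ : ∀ {n} (p : Subset (suc n)) v → ∣ Vec.lookup p v ∷ removeAt p v ∣ ≡ ∣ p ∣
∣removeAt∣ p v = trans (sym (∣insertAt∣ (removeAt p v) v (Vec.lookup p v))) (cong ∣_∣ (insertAt-removeAt p v))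

∣[]≔inside∣ : ∀ {n} (p : Subset n) i → ∣ p [ i ]≔ inside ∣ ≤ suc ∣ p ∣
∣[]≔inside∣ (x ∷ p)     zero    = s≤s (∣p∣≤∣x∷p∣ x p)
∣[]≔inside∣ (true ∷ p)  (suc i) = s≤s (∣[]≔inside∣ p i)
∣[]≔inside∣ (false ∷ p) (suc i) = ∣[]≔inside∣ p i

-- The reduction

module Reduction {N : ℕ} (adj : Graph (suc N)) (p : ℕ → Fin (suc N)) (simple : Simple adj)
                 {h : ℕ} (4≤h : 4 ≤ h) (path : DegreeTwoPath adj h p) where

  open DegreeTwoPath path
  open PathPartition

  v₀ v₁ v₂ v₃ v₄ : Fin (suc N)
  v₀ = p 0
  v₁ = p 1
  v₂ = p 2
  v₃ = p 3
  v₄ = p 4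

  Paths : Set
  Paths = List (List (Fin (suc N)))

  E : Fin (suc N) → Fin (suc N) → Set
  E = Edge adj

  E-sym : ∀ {x y} → E x y → E y x
  E-sym {x} {y} e = trans (Simple.sym simple y x) e

  E-irrefl : ∀ {x} → ¬ E x x
  E-irrefl {x} e = case trans (sym e) (Simple.irrefl simple x) of λ ()

  private
    <h : ∀ {k} → k < 4 → k < h
    <h k<4 = ℕ.≤-trans k<4 4≤h

    inner-distinct : ∀ {i j} → 0 < i → i < j → j ≤ h → p i ≢ p j
    inner-distinct 0<i i<j j≤h e with distinct _ _ i<j j≤h e
    ... | refl , _ = case 0<i of λ ()

    start-distinct : ∀ {j} → 0 < j → j < h → v₀ ≢ p j
    start-distinct 0<j j<h e = ℕ.<⇒≢ j<h (proj₂ (distinct 0 _ 0<j (ℕ.<⇒≤ j<h) e))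

  v₁≢v₂ : v₁ ≢ v₂
  v₁≢v₂ = inner-distinct z<s (s<s z<s) (ℕ.<⇒≤ (<h (s<s (s<s z<s))))
  v₂≢v₃ : v₂ ≢ v₃
  v₂≢v₃ = inner-distinct z<s (s<s (s<s z<s)) (ℕ.<⇒≤ (<h (s<s (s<s (s<s z<s)))))
  v₁≢v₃ : v₁ ≢ v₃
  v₁≢v₃ = inner-distinct z<s (s<s z<s) (ℕ.<⇒≤ (<h (s<s (s<s (s<s z<s)))))
  v₂≢v₄ : v₂ ≢ v₄
  v₂≢v₄ = inner-distinct z<s (s<s (s<s z<s)) 4≤h
  v₀≢v₂ : v₀ ≢ v₂
  v₀≢v₂ = start-distinct z<s (<h (s<s (s<s z<s)))
  v₀≢v₃ : v₀ ≢ v₃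
  v₀≢v₃ = start-distinct z<s (<h (s<s (s<s (s<s z<s))))

  E-v₀v₁ : E v₀ v₁
  E-v₀v₁ = consecutive 0 (<h z<s)
  E-v₁v₂ : E v₁ v₂
  E-v₁v₂ = consecutive 1 (<h (s<s z<s))
  E-v₂v₃ : E v₂ v₃
  E-v₂v₃ = consecutive 2 (<h (s<s (s<s z<s)))
  E-v₃v₄ : E v₃ v₄
  E-v₃v₄ = consecutive 3 (<h (s<s (s<s (s<s z<s))))

  E-v₁ : ∀ {y} → E v₁ y → y ≡ v₀ ⊎ y ≡ v₂
  E-v₁ = Edge-deg-two adj (innerDeg 1 z<s (<h (s<s z<s))) (E-sym E-v₀v₁) E-v₁v₂ v₀≢v₂

  E-v₂ : ∀ {y} → E v₂ y ⇔ (y ≡ v₁ ⊎ y ≡ v₃)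
  E-v₂ = mk⇔ (Edge-deg-two adj (innerDeg 2 z<s (<h (s<s (s<s z<s)))) (E-sym E-v₁v₂) E-v₂v₃ v₁≢v₃)
             Sum.[ (λ { refl → E-sym E-v₁v₂ }) , (λ { refl → E-v₂v₃ }) ]

  E-v₃ : ∀ {y} → E v₃ y → y ≡ v₂ ⊎ y ≡ v₄
  E-v₃ = Edge-deg-two adj (innerDeg 3 z<s (<h (s<s (s<s (s<s z<s))))) (E-sym E-v₂v₃) E-v₃v₄ v₂≢v₄

  ¬E-v₁v₃ : ¬ E v₁ v₃
  ¬E-v₁v₃ e = Sum.[ v₀≢v₃ ∘ sym , v₂≢v₃ ∘ sym ] (E-v₁ e)

  -- The edges of G′, carried over to G along ι (see reduce-Edge).
  E′ : Fin (suc N) → Fin (suc N) → Set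
  E′ x y = E x y ⊎ Pair v₁ v₃ x y

  E⇔E′ : ∀ {x y} → ¬ Pair v₁ v₃ x y → E x y ⇔ E′ x y
  E⇔E′ ¬pair = mk⇔ inj₁ Sum.[ id , ⊥-elim ∘ ¬pair ]

  ι : Fin N → Fin (suc N)
  ι = punchIn v₂

  -- A left inverse of ι; its value at v₂ is junk.
  out : Fin (suc N) → Fin N
  out x with v₂ ≟ᶠ x
  ... | yes _    = punchOut (v₁≢v₂ ∘ sym)
  ... | no v₂≢x = punchOut v₂≢x

  ι-out : ∀ {x} → x ≢ v₂ → ι (out x) ≡ x
  ι-out {x} x≢v₂ with v₂ ≟ᶠ x
  ... | yes v₂≡x = ⊥-elim (x≢v₂ (sym v₂≡x))
  ... | no v₂≢x  = punchIn-punchOut v₂≢x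

  out-ι : ∀ {i} → out (ι i) ≡ i
  out-ι {i} = punchIn-injective v₂ _ _ (ι-out (punchInᵢ≢i v₂ i))

  out-injective : ∀ {x y} → x ≢ v₂ → y ≢ v₂ → out x ≡ out y → x ≡ y
  out-injective x≢v₂ y≢v₂ e = trans (sym (ι-out x≢v₂)) (trans (cong ι e) (ι-out y≢v₂))

  -- The vertices of G′ − S′, seen in G.
  record Kept (S′ : Subset N) (x : Fin (suc N)) : Set where
    constructor kept
    field
      ≢v₂ : x ≢ v₂
      ∉S′ : Vec.lookup S′ (out x) ≡ false

  ι-kept : ∀ {S′ i} → i ∉ₛ S′ → Kept S′ (ι i)
  ι-kept {S′} i∉ = kept (punchInᵢ≢i v₂ _) (trans (cong (Vec.lookup S′) out-ι) (to ∉ₛ⇔≡false i∉))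

  toReduced : ∀ {S′ ps} → PathPartition E′ (Kept S′) ps → DisjointInducedPaths (reduce adj p) S′
  toReduced {S′} π = PathPartition⇒DisjointInducedPaths (reduce adj p) S′
    (PathPartition-map out (λ ix iy → out-injective (Kept.≢v₂ ix) (Kept.≢v₂ iy)) kept⇔ reduced⇔ π)
    where
      kept⇔ : ∀ {i} → i ∉ₛ S′ ⇔ (Σ (Fin (suc N)) λ x → Kept S′ x × out x ≡ i)
      kept⇔ = mk⇔
        (λ i∉ → ι _ , ι-kept i∉ , out-ι)
        (λ { (_ , kept _ e , refl) → from ∉ₛ⇔≡false e })
      reduced⇔ : ∀ {x y} → Kept S′ x → Kept S′ y → Edge (reduce adj p) (out x) (out y) ⇔ E′ x y
      reduced⇔ (kept x≢v₂ _) (kept y≢v₂ _) =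
        subst₂ (λ a b → Edge (reduce adj p) (out _) (out _) ⇔ E′ a b) (ι-out x≢v₂) (ι-out y≢v₂)
               (reduce-Edge adj p _ _)

  fromReduced : ∀ {S′} → DisjointInducedPaths (reduce adj p) S′ → Σ Paths (PathPartition E′ (Kept S′))
  fromReduced {S′} D =
    _ , PathPartition-map ι (λ _ _ → punchIn-injective v₂ _ _) kept⇔ (λ _ _ → ⇔.sym (reduce-Edge adj p _ _))
                          (DisjointInducedPaths⇒PathPartition (reduce adj p) S′ D)
    where
      kept⇔ : ∀ {x} → Kept S′ x ⇔ (Σ (Fin N) λ i → i ∉ₛ S′ × ι i ≡ x)
      kept⇔ = mk⇔
        (λ { (kept x≢v₂ e) → out _ , from ∉ₛ⇔≡false e , ι-out x≢v₂ })
        (λ { (i , i∉ , refl) → ι-kept i∉ })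

  ReducedSolution : Subset (suc N) → Set
  ReducedSolution S = Σ (Subset N) λ S′ → ∣ S′ ∣ ≤ ∣ S ∣ × Σ Paths (PathPartition E′ (Kept S′))

  forward-v₂∈S : ∀ S {ps} → Vec.lookup S v₂ ≡ true → PathPartition E (_∉ₛ S) ps → ReducedSolution S
  forward-v₂∈S S v₂∈S π with delete-vertex v₁ (¬? (v₁ ∈? S)) π
  ... | ps′ , π′ = S′ , card , ps′ , PathPartition-cong kept⇔ (λ ix iy → E⇔E′ (¬pair ix iy)) π′
    where
      S′ = removeAt S v₂ [ out v₁ ]≔ inside
      card : ∣ S′ ∣ ≤ ∣ S ∣
      card = ℕ.≤-trans (∣[]≔inside∣ (removeAt S v₂) (out v₁))
                       (ℕ.≤-reflexive (subst (λ b → ∣ b ∷ removeAt S v₂ ∣ ≡ ∣ S ∣) v₂∈S (∣removeAt∣ S v₂)))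
      lookup-S′ : ∀ {x} → x ≢ v₂ → x ≢ v₁ → Vec.lookup S′ (out x) ≡ Vec.lookup S x
      lookup-S′ {x} x≢v₂ x≢v₁ =
        trans (lookup∘update′ (λ e → x≢v₁ (out-injective x≢v₂ v₁≢v₂ e)) (removeAt S v₂) inside)
              (trans (lookup-removeAt S v₂ (out x)) (cong (Vec.lookup S) (ι-out x≢v₂)))
      ∉S⇒≢v₂ : ∀ {x} → x ∉ₛ S → x ≢ v₂
      ∉S⇒≢v₂ x∉ refl = x∉ (lookup⇒[]= v₂ S v₂∈S)
      ∉S′⇒≢v₁ : ∀ {x} → Vec.lookup S′ (out x) ≡ false → x ≢ v₁
      ∉S′⇒≢v₁ e refl = case trans (sym (lookup∘update (out v₁) (removeAt S v₂) inside)) e of λ ()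
      kept⇔ : ∀ {x} → (x ∉ₛ S × x ≢ v₁) ⇔ Kept S′ x
      kept⇔ = mk⇔
        (λ { (x∉ , x≢v₁) → kept (∉S⇒≢v₂ x∉) (trans (lookup-S′ (∉S⇒≢v₂ x∉) x≢v₁) (to ∉ₛ⇔≡false x∉)) })
        (λ { (kept x≢v₂ e) → from ∉ₛ⇔≡false (trans (sym (lookup-S′ x≢v₂ (∉S′⇒≢v₁ e))) e) , ∉S′⇒≢v₁ e })
      ¬pair : ∀ {x y} → x ∉ₛ S × x ≢ v₁ → y ∉ₛ S × y ≢ v₁ → ¬ Pair v₁ v₃ x y
      ¬pair (_ , x≢v₁) _ (inj₁ (x≡v₁ , _)) = x≢v₁ x≡v₁
      ¬pair _ (_ , y≢v₁) (inj₂ (_ , y≡v₁)) = y≢v₁ y≡v₁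

  contract-v₂ : ∀ {S ps} → v₂ ∉ₛ S → v₁ ∉ₛ S → v₃ ∉ₛ S → PathPartition E (_∉ₛ S) ps →
                Σ Paths (PathPartition E′ (λ x → x ∉ₛ S × x ≢ v₂))
  contract-v₂ {S} {ps} v₂∉ v₁∉ v₃∉ π with ∈-concat⇒spliced {ps = ps} (from (covers π) v₂∉)
  ... | c , refl = joined c , PathPartition-cong ⇔.refl (λ _ _ → ⇔.refl ⊎-⇔ seamed⇔) (join c (delete c π))
    where
      end⇔ : ∀ {y} → y ∉ₛ S → End c y ⇔ E v₂ y
      end⇔ y∉ = ⇔.sym (⇔.trans (linked π v₂∉ y∉)
                               (Linked-spliced-new c (proj₁ (to (unique-spliced c) (unique π)))))
      seamed⇔ : ∀ {x y} → Seamed c x y ⇔ Pair v₁ v₃ x y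
      seamed⇔ with End⇒Seam c (from (end⇔ v₁∉) (E-sym E-v₁v₂)) (from (end⇔ v₃∉) E-v₂v₃) v₁≢v₃
      ... | inj₁ s = Seam⇒Seamed c s
      ... | inj₂ s = ⇔.trans (Seam⇒Seamed c s) Pair-sym

  forward-v₂∉S : ∀ S {ps} → Vec.lookup S v₂ ≡ false → PathPartition E (_∉ₛ S) ps → ReducedSolution S
  forward-v₂∉S S v₂∉S π = removeAt S v₂ , card , partition (¬? (v₁ ∈? S) ×-dec ¬? (v₃ ∈? S))
    where
      card : ∣ removeAt S v₂ ∣ ≤ ∣ S ∣
      card = ℕ.≤-reflexive (subst (λ b → ∣ b ∷ removeAt S v₂ ∣ ≡ ∣ S ∣) v₂∉S (∣removeAt∣ S v₂))
      lookup-out : ∀ {x} → x ≢ v₂ → Vec.lookup (removeAt S v₂) (out x) ≡ Vec.lookup S x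
      lookup-out x≢v₂ = trans (lookup-removeAt S v₂ _) (cong (Vec.lookup S) (ι-out x≢v₂))
      kept⇔ : ∀ {x} → (x ∉ₛ S × x ≢ v₂) ⇔ Kept (removeAt S v₂) x
      kept⇔ = mk⇔ (λ { (x∉ , x≢v₂) → kept x≢v₂ (trans (lookup-out x≢v₂) (to ∉ₛ⇔≡false x∉)) })
                  (λ { (kept x≢v₂ e) → from ∉ₛ⇔≡false (trans (sym (lookup-out x≢v₂)) e) , x≢v₂ })
      partition : Dec (v₁ ∉ₛ S × v₃ ∉ₛ S) → Σ Paths (PathPartition E′ (Kept (removeAt S v₂)))
      partition (yes (v₁∉ , v₃∉)) = Product.map₂ (PathPartition-cong kept⇔ (λ _ _ → ⇔.refl))
                                      (contract-v₂ (from ∉ₛ⇔≡false v₂∉S) v₁∉ v₃∉ π)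
      partition (no ¬both) = Product.map₂ (PathPartition-cong kept⇔ λ ix iy → E⇔E′ (¬pair ix iy))
                               (delete-vertex v₂ (yes (from ∉ₛ⇔≡false v₂∉S)) π)
        where
          ¬pair : ∀ {x y} → x ∉ₛ S × x ≢ v₂ → y ∉ₛ S × y ≢ v₂ → ¬ Pair v₁ v₃ x y
          ¬pair (x∉ , _) (y∉ , _) (inj₁ (refl , refl)) = ¬both (x∉ , y∉)
          ¬pair (x∉ , _) (y∉ , _) (inj₂ (refl , refl)) = ¬both (y∉ , x∉)

  forward-partition : ∀ S {ps} → PathPartition E (_∉ₛ S) ps → ReducedSolution S
  forward-partition S π with Vec.lookup S v₂ in v₂∈?S
  ... | true  = forward-v₂∈S S v₂∈?S π
  ... | false = forward-v₂∉S S v₂∈?S π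

  forward : ∀ k → CoPathPacking adj k → CoPathPacking (reduce adj p) k
  forward k (S , |S|≤k , D) with forward-partition S (DisjointInducedPaths⇒PathPartition adj S D)
  ... | S′ , |S′|≤|S| , _ , π = S′ , ℤ.≤-trans (+≤+ |S′|≤|S|) |S|≤k , toReduced π

  kept? : ∀ S′ x → Dec (Kept S′ x)
  kept? S′ x = map′ (λ { (x≢v₂ , e) → kept x≢v₂ e }) (λ { (kept x≢v₂ e) → x≢v₂ , e })
                   (¬? (x ≟ᶠ v₂) ×-dec (Vec.lookup S′ (out x) ≟ᵇ false))

  -- A place for v₂ in a path partition of G′ − S′: the ends of the cut become its neighbours,
  -- and the seam of the cut is the edge v₁v₃ of G′ that it subdivides (if any).
  Site : Subset N → Set
  Site S′ = Σ Cut λ c → PathPartition E′ (Kept S′) (joined c)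
                      × (∀ {x y} → Kept S′ x → Kept S′ y → Seamed c x y ⇔ Pair v₁ v₃ x y)
                      × (∀ {y} → Kept S′ y → End c y ⇔ E v₂ y)

  site-between : ∀ {S′ ps} → Kept S′ v₁ → Kept S′ v₃ → PathPartition E′ (Kept S′) ps → Site S′
  site-between {ps = ps} k₁ k₃ π with to (linked π k₁ k₃) (inj₂ (inj₁ (refl , refl)))
  ... | inj₁ s with Succ⇒joined {ps = ps} s
  ...   | c , refl , seam = c , π , (λ _ _ → Seam⇒Seamed c seam) , λ _ → ⇔.trans (Seam⇒End c seam) (⇔.sym E-v₂)
  site-between {ps = ps} k₁ k₃ π | inj₂ s with Succ⇒joined {ps = ps} s
  ...   | c , refl , seam = c , π , (λ _ _ → ⇔.trans (Seam⇒Seamed c seam) Pair-sym) ,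
                            λ _ → ⇔.trans (Seam⇒End c seam) (⇔.trans (mk⇔ Sum.swap Sum.swap) (⇔.sym E-v₂))

  site-end : ∀ {S′ ps w z} → Kept S′ w →
    (∀ {y} → Kept S′ y → E′ w y → y ≡ z) →
    (∀ {y} → Kept S′ y → E v₂ y ⇔ y ≡ w) →
    (∀ {x y} → Kept S′ x → Kept S′ y → ¬ Pair v₁ v₃ x y) →
    PathPartition E′ (Kept S′) ps → Site S′
  site-end {ps = ps} kw E′-w E-v₂-kept ¬pair π with ∈-concat⇒end⊎inner {ps = ps} (from (covers π) kw)
  ... | inj₁ (c , refl , ¬seamed , end⇔) =
    c , π , (λ kx ky → mk⇔ (⊥-elim ∘ ¬seamed) (⊥-elim ∘ ¬pair kx ky)) ,
    λ ky → ⇔.trans end⇔ (⇔.sym (E-v₂-kept ky))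
  -- An inner vertex of a path has two distinct neighbours on it, but w has only one kept neighbour.
  ... | inj₂ (a , b , aw , wb) = ⊥-elim (Consecutive-asym (unique π) (Succ⇒Consecutive-concat aw)
                                   (subst (λ b → Consecutive (concat ps) _ b) (sym a≡b) (Succ⇒Consecutive-concat wb)))
    where
      ka = to (covers π) (proj₁ (Succ-∈ aw))
      kb = to (covers π) (proj₂ (Succ-∈ wb))
      a≡b = trans (E′-w ka (from (linked π kw ka) (inj₂ aw))) (sym (E′-w kb (from (linked π kw kb) (inj₁ wb))))

  site-none : ∀ {S′ ps} → ¬ Kept S′ v₁ → ¬ Kept S′ v₃ → PathPartition E′ (Kept S′) ps → Site S′
  site-none {ps = ps} ¬k₁ ¬k₃ π =
    cut [] [] [] ps , PathPartition-∷[] π ,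
    (λ kx ky → mk⇔ (λ { (inj₁ (() , _)) ; (inj₂ (() , _)) })
                   (λ { (inj₁ (refl , _)) → ⊥-elim (¬k₁ kx) ; (inj₂ (refl , _)) → ⊥-elim (¬k₃ kx) })) ,
    λ ky → mk⇔ (λ { (inj₁ ()) ; (inj₂ ()) }) (λ e → case to E-v₂ e of λ
                 { (inj₁ refl) → ⊥-elim (¬k₁ ky) ; (inj₂ refl) → ⊥-elim (¬k₃ ky) })

  module _ {S′ : Subset N} where

    ¬Pair-unkept : ¬ Kept S′ v₁ ⊎ ¬ Kept S′ v₃ → ∀ {x y} → Kept S′ x → Kept S′ y → ¬ Pair v₁ v₃ x y
    ¬Pair-unkept (inj₁ ¬k₁) kx _  (inj₁ (refl , _)) = ¬k₁ kx
    ¬Pair-unkept (inj₁ ¬k₁) _  ky (inj₂ (_ , refl)) = ¬k₁ ky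
    ¬Pair-unkept (inj₂ ¬k₃) _  ky (inj₁ (_ , refl)) = ¬k₃ ky
    ¬Pair-unkept (inj₂ ¬k₃) kx _  (inj₂ (refl , _)) = ¬k₃ kx

    E-v₂-unkept-v₃ : ¬ Kept S′ v₃ → ∀ {y} → Kept S′ y → E v₂ y ⇔ y ≡ v₁
    E-v₂-unkept-v₃ ¬k₃ ky = mk⇔ (λ e → Sum.[ id , (λ { refl → ⊥-elim (¬k₃ ky) }) ] (to E-v₂ e))
                                (λ { refl → E-sym E-v₁v₂ })

    E-v₂-unkept-v₁ : ¬ Kept S′ v₁ → ∀ {y} → Kept S′ y → E v₂ y ⇔ y ≡ v₃
    E-v₂-unkept-v₁ ¬k₁ ky = mk⇔ (λ e → Sum.[ (λ { refl → ⊥-elim (¬k₁ ky) }) , id ] (to E-v₂ e))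
                                (λ { refl → E-v₂v₃ })

    E′-v₁-unkept-v₃ : ¬ Kept S′ v₃ → ∀ {y} → Kept S′ y → E′ v₁ y → y ≡ v₀
    E′-v₁-unkept-v₃ ¬k₃ ky (inj₁ e) = Sum.[ id , (λ { refl → ⊥-elim (Kept.≢v₂ ky refl) }) ] (E-v₁ e)
    E′-v₁-unkept-v₃ ¬k₃ ky (inj₂ (inj₁ (_ , refl)))  = ⊥-elim (¬k₃ ky)
    E′-v₁-unkept-v₃ ¬k₃ ky (inj₂ (inj₂ (v₁≡v₃ , _))) = ⊥-elim (v₁≢v₃ v₁≡v₃)

    E′-v₃-unkept-v₁ : ¬ Kept S′ v₁ → ∀ {y} → Kept S′ y → E′ v₃ y → y ≡ v₄
    E′-v₃-unkept-v₁ ¬k₁ ky (inj₁ e) = Sum.[ (λ { refl → ⊥-elim (Kept.≢v₂ ky refl) }) , id ] (E-v₃ e)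
    E′-v₃-unkept-v₁ ¬k₁ ky (inj₂ (inj₁ (v₃≡v₁ , _))) = ⊥-elim (v₁≢v₃ (sym v₃≡v₁))
    E′-v₃-unkept-v₁ ¬k₁ ky (inj₂ (inj₂ (_ , refl)))  = ⊥-elim (¬k₁ ky)

  site : ∀ {S′ ps} → PathPartition E′ (Kept S′) ps → Site S′
  site {S′} π with kept? S′ v₁ | kept? S′ v₃
  ... | yes k₁  | yes k₃  = site-between k₁ k₃ π
  ... | yes k₁  | no ¬k₃ =
    site-end k₁ (E′-v₁-unkept-v₃ ¬k₃) (E-v₂-unkept-v₃ ¬k₃) (¬Pair-unkept (inj₂ ¬k₃)) π
  ... | no ¬k₁ | yes k₃  =
    site-end k₃ (E′-v₃-unkept-v₁ ¬k₁) (E-v₂-unkept-v₁ ¬k₁) (¬Pair-unkept (inj₁ ¬k₁)) π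
  ... | no ¬k₁ | no ¬k₃ = site-none ¬k₁ ¬k₃ π

  splice-v₂ : ∀ {S′} → Site S′ → Σ Paths (PathPartition E (_∉ₛ insertAt S′ v₂ false))
  splice-v₂ {S′} (c , π , seamed⇔ , end⇔) =
    spliced c v₂ , PathPartition-cong unsplit (λ _ _ → ⇔.refl)
                     (splice c π (λ k → Kept.≢v₂ k refl) E-sym old (⇔.sym ∘ end⇔) E-irrefl)
    where
      old : ∀ {x y} → Kept S′ x → Kept S′ y → E x y ⇔ (E′ x y × ¬ Seamed c x y)
      old kx ky = mk⇔
        (λ e → inj₁ e , λ s → case to (seamed⇔ kx ky) s of λ
           { (inj₁ (refl , refl)) → ¬E-v₁v₃ e ; (inj₂ (refl , refl)) → ¬E-v₁v₃ (E-sym e) })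
        (λ { (inj₁ e , _) → e ; (inj₂ pair , ¬s) → ⊥-elim (¬s (from (seamed⇔ kx ky) pair)) })
      lookup-insertAt : ∀ {x} → x ≢ v₂ → Vec.lookup (insertAt S′ v₂ false) x ≡ Vec.lookup S′ (out x)
      lookup-insertAt x≢v₂ = subst (λ z → Vec.lookup (insertAt S′ v₂ false) z ≡ Vec.lookup S′ (out _))
                                   (ι-out x≢v₂) (insertAt-punchIn S′ v₂ false (out _))
      unsplit : ∀ {x} → (Kept S′ x ⊎ x ≡ v₂) ⇔ x ∉ₛ insertAt S′ v₂ false
      unsplit {x} = mk⇔
        (λ { (inj₁ (kept x≢v₂ e)) → from ∉ₛ⇔≡false (trans (lookup-insertAt x≢v₂) e)
           ; (inj₂ refl)          → from ∉ₛ⇔≡false (insertAt-lookup S′ v₂ false) })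
        (λ x∉ → case x ≟ᶠ v₂ of λ
           { (yes x≡v₂) → inj₂ x≡v₂
           ; (no x≢v₂)  → inj₁ (kept x≢v₂ (trans (sym (lookup-insertAt x≢v₂)) (to ∉ₛ⇔≡false x∉))) })

  backward : ∀ k → CoPathPacking (reduce adj p) k → CoPathPacking adj k
  backward k (S′ , |S′|≤k , D′) =
    insertAt S′ v₂ false , subst (λ n → + n ≤ℤ k) (sym (∣insertAt∣ S′ v₂ false)) |S′|≤k ,
    PathPartition⇒DisjointInducedPaths adj _ (proj₂ (splice-v₂ (site (proj₂ (fromReduced D′)))))

lemma23 : ∀ {N : ℕ} (adj : Graph (suc N)) (k : ℤ) (h : ℕ) (p : ℕ → Fin (suc N)) →
    Simple adj → 4 ≤ h → DegreeTwoPath adj h p →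
    (CoPathPacking adj k ⇔ CoPathPacking (reduce adj p) k)
lemma23 adj k h p simple 4≤h path = mk⇔ (forward k) (backward k)
  where open Reduction adj p simple 4≤h path
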